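{- For each integer $n\geq 0$ and every $x\in\mathbb{C}$, \[ \sum_{k=0}^{\lfloor n/2\rfloor} \binom{n}{2k} C_{2(n-2k)}(x)\,\bigl(36x^2(9x^2-1)\bigr)^{k} E_{2k} = \sum_{k=0}^n \binom{n}{k} \bigl( C_{2k}(x) - \sqrt{9x^2-1}\,B_{2k}^*(x)\bigr)\bigl(6x\sqrt{9x^2-1}\bigr)^{n-k}, \] where $\sqrt{9x^2-1}$ denotes a fixed square root of $9x^2-1$ (the same one throughout).
   Context: Balancing polynomials $B_n^*(x)$ and Lucas-balancing polynomials $C_n(x)$ are defined by the recurrence $w_n(x)=6x\,w_{n-1}(x)-w_{n-2}(x)$ for $n\geq 2$, with $B_0^*(x)=0$, $B_1^*(x)=1$ and $C_0(x)=1$, $C_1(x)=3x$. Euler numbers $E_n$ are defined by $\sum_{n\geq 0}E_n\frac{z^n}{n!}=\frac{1}{\cosh z}$. -}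

module Defs where

open import Data.Nat as ℕ using (ℕ; zero; suc; ⌊_/2⌋)
open import Data.Nat.Combinatorics using (_C_)
open import Data.Nat.DivMod using (_%_)
open import Data.Integer as ℤ using (ℤ; +_; -[1+_])
open import Data.Fin using (Fin; toℕ)
open import Data.Vec as Vec using (Vec; []; _∷_; _∷ʳ_; lookup; tabulate)
open import Data.Bool using (if_then_else_)
open import Algebra.Bundles using (CommutativeRing)

-- Euler numbers E_n (integers), defined by  Σ E_n z^n/n! = 1/cosh z.
-- Multiplying by cosh z = Σ z^{2j}/(2j)! gives the defining recurrence:
--   E_odd = 0,   E_0 = 1,
--   Σ_{k=0}^{m} binom(2m,2k) E_{2k} = 0   for m ≥ 1.

eulerEvens : (m : ℕ) → Vec ℤ (suc m)
eulerEvens zero    = + 1 ∷ []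
eulerEvens (suc m) = es ∷ʳ next
  where
  es : Vec ℤ (suc m)
  es = eulerEvens m
  next : ℤ
  next = ℤ.- Vec.foldr _ ℤ._+_ (+ 0) (tabulate (λ (k : Fin (suc m)) →
           (+ ((2 ℕ.* suc m) C (2 ℕ.* toℕ k))) ℤ.* lookup es k))

eulerEven : ℕ → ℤ
eulerEven m = Vec.last (eulerEvens m)

euler : ℕ → ℤ
euler n = if (n % 2) ℕ.≡ᵇ 0 then eulerEven ⌊ n /2⌋ else + 0

module InRing {c ℓ} (R : CommutativeRing c ℓ) where
  open CommutativeRing R

  fromℕ : ℕ → Carrier
  fromℕ zero    = 0#
  fromℕ (suc n) = 1# + fromℕ n

  fromℤ : ℤ → Carrier
  fromℤ (+ n)      = fromℕ n
  fromℤ -[1+ n ]   = - fromℕ (suc n)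

  infixr 8 _^_
  _^_ : Carrier → ℕ → Carrier
  a ^ zero  = 1#
  a ^ suc n = a * (a ^ n)

  Σ[0…_] : ℕ → (ℕ → Carrier) → Carrier
  Σ[0… zero  ] f = f 0
  Σ[0… suc n ] f = Σ[0… n ] f + f (suc n)

  rec : Carrier → Carrier → Carrier → ℕ → Carrier
  rec x w0 w1 zero          = w0
  rec x w0 w1 (suc zero)    = w1
  rec x w0 w1 (suc (suc n)) =
    fromℕ 6 * x * rec x w0 w1 (suc n) - rec x w0 w1 n

  Bstar : ℕ → Carrier → Carrier
  Bstar n x = rec x 0# 1# n

  Cpoly : ℕ → Carrier → Carrier
  Cpoly n x = rec x 1# (fromℕ 3 * x) n

-- Put t = 6x, w = 9x² − 1, a = C₂(x) = 18x² − 1 and D = 36x²w. The addition formulas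
-- C_{n+2} = a C_n + tw B*_n and B*_{n+2} = t C_n + a B*_n show that (C_{2m}, B*_{2m}) is the
-- first column of (aI + N)^m with N = [[0, tw], [t, 0]] and N² = D·I. Hence C_{2m} is the even
-- part of the binomial expansion of (a + N)^m, and C_{2m} − s B*_{2m} = (a − 6xs)^m when s² = w.
-- For exponential generating functions the first fact reads Σ C_{2m} z^m/m! = e^{az} cosh(√D z),
-- so the left-hand side, being the coefficient of z^n/n! in its product with
-- sech(√D z) = Σ E_{2k} D^k z^{2k}/(2k)!, is that of e^{az}. The second fact makes the right-hand
-- side the binomial expansion of ((a − 6xs) + 6xs)^n. Both sides are therefore a^n.
-- Without division, generating functions are replaced by the binomial convolution
-- (f ⋆ g) n = Σ_j C(n,j) f(n−j) g(j) of their coefficient sequences.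

module Submission where

open import Defs
open import Data.Nat.Base as ℕ using (ℕ; zero; suc; ⌊_/2⌋; _∸_; _≤_) renaming (_*_ to _*ℕ_)
import Data.Nat.Properties as ℕ
open import Data.Nat.Combinatorics using (_C_; nCk+nC[k+1]≡[n+1]C[k+1]; nCn≡1; k>n⇒nCk≡0)
open import Data.Nat.DivMod using (_%_; m*n%n≡0; [m+kn]%n≡m%n)
open import Data.Integer.Base as ℤ using (ℤ; +_; -[1+_]; _⊖_)
import Data.Integer.Properties as ℤ
open import Data.Fin.Base as Fin using (Fin; toℕ; inject₁)
import Data.Fin.Properties as Fin
open import Data.Fin.Relation.Unary.Top using (view; ‵fromℕ; ‵inject₁)
open import Data.Vec.Base as Vec using (Vec; _∷_; _∷ʳ_; lookup; tabulate)
import Data.Vec.Properties as Vec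
open import Data.Product.Base using (_×_; _,_; proj₁; proj₂)
open import Data.Bool.Base using (if_then_else_)
open import Data.Maybe.Base using (Maybe; just; nothing)
open import Function.Base using (_∘_)
open import Relation.Nullary.Decidable using (yes; no)
import Relation.Binary.PropositionalEquality as ≡
open ≡ using (_≡_)
open import Algebra.Bundles using (CommutativeRing)
import Algebra.Solver.Ring
import Algebra.Solver.Ring.AlmostCommutativeRing as AlmostCommutativeRing

-- Euler numbers and parity

data EvenOdd : ℕ → Set where
  even : ∀ k → EvenOdd (2 *ℕ k)
  odd  : ∀ k → EvenOdd (suc (2 *ℕ k))

evenOdd : ∀ n → EvenOdd n
evenOdd zero = even 0
evenOdd (suc n) with evenOdd n
... | even k = odd k
... | odd k  = ≡.subst EvenOdd (ℕ.*-suc 2 k) (even (suc k))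

⌊2*n/2⌋≡n : ∀ n → ⌊ 2 *ℕ n /2⌋ ≡ n
⌊2*n/2⌋≡n n = ≡.sym (≡.trans (ℕ.n≡⌊n+n/2⌋ n) (≡.cong (λ m → ⌊ n ℕ.+ m /2⌋) (≡.sym (ℕ.+-identityʳ n))))

euler-double : ∀ k → euler (2 *ℕ k) ≡ eulerEven k
euler-double k = ≡.cong₂ (λ r h → if r ℕ.≡ᵇ 0 then eulerEven h else + 0)
  (≡.trans (≡.cong (_% 2) (ℕ.*-comm 2 k)) (m*n%n≡0 k 2)) (⌊2*n/2⌋≡n k)

euler-odd : ∀ k → euler (suc (2 *ℕ k)) ≡ + 0
euler-odd k = ≡.cong (λ r → if r ℕ.≡ᵇ 0 then eulerEven ⌊ suc (2 *ℕ k) /2⌋ else + 0)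
  (≡.trans (≡.cong (λ m → suc m % 2) (ℕ.*-comm 2 k)) ([m+kn]%n≡m%n 1 k 2))

lookup-∷ʳ-inject₁ : ∀ {A : Set} {n} (xs : Vec A n) y i → lookup (xs ∷ʳ y) (inject₁ i) ≡ lookup xs i
lookup-∷ʳ-inject₁ (x ∷ xs) y Fin.zero    = ≡.refl
lookup-∷ʳ-inject₁ (x ∷ xs) y (Fin.suc i) = lookup-∷ʳ-inject₁ xs y i

lookup-∷ʳ-fromℕ : ∀ {A : Set} {n} (xs : Vec A n) y → lookup (xs ∷ʳ y) (Fin.fromℕ n) ≡ y
lookup-∷ʳ-fromℕ Vec.[]   y = ≡.refl
lookup-∷ʳ-fromℕ (x ∷ xs) y = lookup-∷ʳ-fromℕ xs y

lookup-eulerEvens : ∀ m (i : Fin (suc m)) → lookup (eulerEvens m) i ≡ eulerEven (toℕ i)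
lookup-eulerEvens zero Fin.zero = ≡.refl
lookup-eulerEvens (suc m) i with view i
... | ‵fromℕ = ≡.trans (lookup-∷ʳ-fromℕ (eulerEvens m) _)
  (≡.trans (≡.sym (Vec.last-∷ʳ _ (eulerEvens m))) (≡.cong eulerEven (≡.sym (Fin.toℕ-fromℕ (suc m)))))
... | ‵inject₁ j = ≡.trans (lookup-∷ʳ-inject₁ (eulerEvens m) _ j)
  (≡.trans (lookup-eulerEvens m j) (≡.cong eulerEven (≡.sym (Fin.toℕ-inject₁ j))))

module _ {c ℓ} (R : CommutativeRing c ℓ) where
  open CommutativeRing R
  open InRing R
  open import Algebra.Properties.Ring ring using (-‿involutive; -0#≈0#; -‿distribˡ-*; -‿distribʳ-*)
  open import Algebra.Properties.AbelianGroup +-abelianGroup using (⁻¹-∙-comm)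
  open import Algebra.Properties.CommutativeSemigroup +-commutativeSemigroup
    using (interchange) renaming (x∙yz≈y∙xz to x+[y+z]≈y+[x+z])
  open import Algebra.Properties.CommutativeSemigroup *-commutativeSemigroup
    using () renaming (x∙yz≈y∙xz to x*[y*z]≈y*[x*z]; xy∙z≈xz∙y to [x*y]*z≈[x*z]*y)
  open import Algebra.Properties.Semiring.Mult semiring using (×-homo-+; ×1-homo-*) renaming (_×_ to _×ₙ_)
  open import Relation.Binary.Reasoning.Setoid setoid

  fromℕ≡×1# : ∀ n → fromℕ n ≡ n ×ₙ 1#
  fromℕ≡×1# zero    = ≡.refl
  fromℕ≡×1# (suc n) = ≡.cong (λ m → 1# + m) (fromℕ≡×1# n)

  fromℕ-+ : ∀ m n → fromℕ (m ℕ.+ n) ≈ fromℕ m + fromℕ n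
  fromℕ-+ m n rewrite fromℕ≡×1# (m ℕ.+ n) | fromℕ≡×1# m | fromℕ≡×1# n = ×-homo-+ 1# m n

  fromℕ-* : ∀ m n → fromℕ (m *ℕ n) ≈ fromℕ m * fromℕ n
  fromℕ-* m n rewrite fromℕ≡×1# (m *ℕ n) | fromℕ≡×1# m | fromℕ≡×1# n = ×1-homo-* m n

  fromℤ-⊖ : ∀ m n → fromℤ (m ⊖ n) ≈ fromℕ m - fromℕ n
  fromℤ-⊖ m zero = begin
    fromℤ (m ⊖ 0)     ≡⟨ ≡.cong fromℤ (ℤ.⊖-≥ {m} {0} ℕ.z≤n) ⟩
    fromℕ m           ≈⟨ +-identityʳ _ ⟨
    fromℕ m + 0#      ≈⟨ +-congˡ -0#≈0# ⟨
    fromℕ m - 0#      ∎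
  fromℤ-⊖ zero (suc n) = sym (+-identityˡ _)
  fromℤ-⊖ (suc m) (suc n) = begin
    fromℤ (suc m ⊖ suc n)                  ≡⟨ ≡.cong fromℤ (ℤ.[1+m]⊖[1+n]≡m⊖n m n) ⟩
    fromℤ (m ⊖ n)                          ≈⟨ fromℤ-⊖ m n ⟩
    fromℕ m - fromℕ n                      ≈⟨ +-identityˡ _ ⟨
    0# + (fromℕ m - fromℕ n)               ≈⟨ +-congʳ (-‿inverseʳ 1#) ⟨
    (1# - 1#) + (fromℕ m - fromℕ n)        ≈⟨ interchange 1# (- 1#) (fromℕ m) (- fromℕ n) ⟩
    (1# + fromℕ m) + (- 1# - fromℕ n)      ≈⟨ +-congˡ (⁻¹-∙-comm 1# (fromℕ n)) ⟩
    (1# + fromℕ m) - (1# + fromℕ n)        ∎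

  fromℤ-neg : ∀ i → fromℤ (ℤ.- i) ≈ - fromℤ i
  fromℤ-neg (+ zero)  = sym -0#≈0#
  fromℤ-neg (+ suc n) = refl
  fromℤ-neg -[1+ n ]  = sym (-‿involutive _)

  fromℤ-+ : ∀ i j → fromℤ (i ℤ.+ j) ≈ fromℤ i + fromℤ j
  fromℤ-+ (+ m)    (+ n)    = fromℕ-+ m n
  fromℤ-+ (+ m)    -[1+ n ] = fromℤ-⊖ m (suc n)
  fromℤ-+ -[1+ m ] (+ n)    = trans (fromℤ-⊖ n (suc m)) (+-comm _ _)
  fromℤ-+ -[1+ m ] -[1+ n ] = begin
    - fromℕ (suc (suc (m ℕ.+ n)))      ≡⟨ ≡.cong (λ k → - fromℕ (suc k)) (ℕ.+-suc m n) ⟨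
    - fromℕ (suc m ℕ.+ suc n)          ≈⟨ -‿cong (fromℕ-+ (suc m) (suc n)) ⟩
    - (fromℕ (suc m) + fromℕ (suc n))  ≈⟨ ⁻¹-∙-comm _ _ ⟨
    - fromℕ (suc m) - fromℕ (suc n)    ∎

  fromℤ-pos-* : ∀ m n → fromℤ (+ m ℤ.* + n) ≈ fromℕ m * fromℕ n
  fromℤ-pos-* m n = trans (reflexive (≡.cong fromℤ (≡.sym (ℤ.pos-* m n)))) (fromℕ-* m n)

  fromℤ-pos-*ˡ : ∀ m j → fromℤ (+ m ℤ.* j) ≈ fromℕ m * fromℤ j
  fromℤ-pos-*ˡ m (+ n)    = fromℤ-pos-* m n
  fromℤ-pos-*ˡ m -[1+ n ] = begin
    fromℤ (+ m ℤ.* ℤ.- + suc n)      ≡⟨ ≡.cong fromℤ (ℤ.neg-distribʳ-* (+ m) (+ suc n)) ⟨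
    fromℤ (ℤ.- (+ m ℤ.* + suc n))    ≈⟨ fromℤ-neg (+ m ℤ.* + suc n) ⟩
    - fromℤ (+ m ℤ.* + suc n)        ≈⟨ -‿cong (fromℤ-pos-* m (suc n)) ⟩
    - (fromℕ m * fromℕ (suc n))      ≈⟨ -‿distribʳ-* _ _ ⟩
    fromℕ m * - fromℕ (suc n)        ∎

  fromℤ-* : ∀ i j → fromℤ (i ℤ.* j) ≈ fromℤ i * fromℤ j
  fromℤ-* (+ m)    j = fromℤ-pos-*ˡ m j
  fromℤ-* -[1+ m ] j = begin
    fromℤ (ℤ.- + suc m ℤ.* j)        ≡⟨ ≡.cong fromℤ (ℤ.neg-distribˡ-* (+ suc m) j) ⟨
    fromℤ (ℤ.- (+ suc m ℤ.* j))      ≈⟨ fromℤ-neg (+ suc m ℤ.* j) ⟩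
    - fromℤ (+ suc m ℤ.* j)          ≈⟨ -‿cong (fromℤ-pos-*ˡ (suc m) j) ⟩
    - (fromℕ (suc m) * fromℤ j)      ≈⟨ -‿distribˡ-* _ _ ⟩
    - fromℕ (suc m) * fromℤ j        ∎

  -- The coefficient map of the ring solver. It agrees with fromℤ, but sends + 1 to 1#
  -- itself, so that goals mentioning 1# can be matched by an expression `con (+ 1)`.
  ι : ℤ → Carrier
  ι (+ 1) = 1#
  ι i     = fromℤ i

  ι≈fromℤ : ∀ i → ι i ≈ fromℤ i
  ι≈fromℤ (+ 0)           = refl
  ι≈fromℤ (+ 1)           = sym (+-identityʳ 1#)
  ι≈fromℤ (+ suc (suc n)) = refl
  ι≈fromℤ -[1+ n ]        = refl

  ι-homomorphism : CommutativeRing.rawRing ℤ.+-*-commutativeRing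
                     AlmostCommutativeRing.-Raw-AlmostCommutative⟶
                   AlmostCommutativeRing.fromCommutativeRing R
  ι-homomorphism = record
    { ⟦_⟧    = ι
    ; +-homo = λ i j → ι-preserves (i ℤ.+ j) (fromℤ-+ i j) (+-cong (ι≈fromℤ i) (ι≈fromℤ j))
    ; *-homo = λ i j → ι-preserves (i ℤ.* j) (fromℤ-* i j) (*-cong (ι≈fromℤ i) (ι≈fromℤ j))
    ; -‿homo = λ i → ι-preserves (ℤ.- i) (fromℤ-neg i) (-‿cong (ι≈fromℤ i))
    ; 0-homo = refl
    ; 1-homo = refl
    }
    where
    ι-preserves : ∀ i {x y} → fromℤ i ≈ y → x ≈ y → ι i ≈ x
    ι-preserves i i≈y x≈y = trans (ι≈fromℤ i) (trans i≈y (sym x≈y))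

  ι-dec : ∀ i j → Maybe (ι i ≈ ι j)
  ι-dec i j with i ℤ.≟ j
  ... | yes i≡j = just (reflexive (≡.cong ι i≡j))
  ... | no _    = nothing

  open Algebra.Solver.Ring _ _ ι-homomorphism ι-dec using (solve; _:=_; _:+_; _:*_; _:-_; con)

  -- Finite sums and binomial convolution

  Σ-cong-≤ : ∀ n {f g : ℕ → Carrier} → (∀ i → i ≤ n → f i ≈ g i) → Σ[0… n ] f ≈ Σ[0… n ] g
  Σ-cong-≤ zero    f≈g = f≈g 0 ℕ.z≤n
  Σ-cong-≤ (suc n) f≈g = +-cong (Σ-cong-≤ n (λ i i≤n → f≈g i (ℕ.m≤n⇒m≤1+n i≤n))) (f≈g (suc n) ℕ.≤-refl)

  Σ-cong : ∀ n {f g : ℕ → Carrier} → (∀ i → f i ≈ g i) → Σ[0… n ] f ≈ Σ[0… n ] g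
  Σ-cong n f≈g = Σ-cong-≤ n (λ i _ → f≈g i)

  Σ-distrib-+ : ∀ n (f g : ℕ → Carrier) → Σ[0… n ] (λ i → f i + g i) ≈ Σ[0… n ] f + Σ[0… n ] g
  Σ-distrib-+ zero    f g = refl
  Σ-distrib-+ (suc n) f g = trans (+-congʳ (Σ-distrib-+ n f g)) (interchange _ _ _ _)

  *-distribˡ-Σ : ∀ x n (f : ℕ → Carrier) → x * Σ[0… n ] f ≈ Σ[0… n ] (λ i → x * f i)
  *-distribˡ-Σ x zero    f = refl
  *-distribˡ-Σ x (suc n) f = trans (distribˡ x _ _) (+-congʳ (*-distribˡ-Σ x n f))

  Σ-head : ∀ n (f : ℕ → Carrier) → Σ[0… suc n ] f ≈ f 0 + Σ[0… n ] (f ∘ suc)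
  Σ-head zero    f = refl
  Σ-head (suc n) f = trans (+-congʳ (Σ-head n f)) (+-assoc _ _ _)

  Σ-even : ∀ n (g : ℕ → Carrier) → (∀ k → g (suc (2 *ℕ k)) ≈ 0#) →
           Σ[0… n ] g ≈ Σ[0… ⌊ n /2⌋ ] (λ k → g (2 *ℕ k))
  Σ-even zero          g g-odd = refl
  Σ-even (suc zero)    g g-odd = trans (+-congˡ (g-odd 0)) (+-identityʳ _)
  Σ-even (suc (suc n)) g g-odd = begin
    Σ[0… suc (suc n) ] g                                 ≈⟨ Σ-head (suc n) g ⟩
    g 0 + Σ[0… suc n ] (g ∘ suc)                         ≈⟨ +-congˡ (Σ-head n (g ∘ suc)) ⟩
    g 0 + (g 1 + Σ[0… n ] (g ∘ suc ∘ suc))               ≈⟨ +-congˡ (+-congʳ (g-odd 0)) ⟩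
    g 0 + (0# + Σ[0… n ] (g ∘ suc ∘ suc))                ≈⟨ +-congˡ (+-identityˡ _) ⟩
    g 0 + Σ[0… n ] (g ∘ suc ∘ suc)                       ≈⟨ +-congˡ (Σ-even n (g ∘ suc ∘ suc) g″-odd) ⟩
    g 0 + Σ[0… ⌊ n /2⌋ ] (λ k → g (suc (suc (2 *ℕ k))))  ≈⟨ +-congˡ (Σ-cong ⌊ n /2⌋ (λ k → reflexive (≡.cong g (ℕ.*-suc 2 k)))) ⟨
    g 0 + Σ[0… ⌊ n /2⌋ ] (λ k → g (2 *ℕ suc k))          ≈⟨ Σ-head ⌊ n /2⌋ (λ k → g (2 *ℕ k)) ⟨
    Σ[0… suc ⌊ n /2⌋ ] (λ k → g (2 *ℕ k))                ∎
    where
    g″-odd : ∀ k → g (suc (suc (suc (2 *ℕ k)))) ≈ 0#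
    g″-odd k = trans (reflexive (≡.cong (g ∘ suc) (≡.sym (ℕ.*-suc 2 k)))) (g-odd (suc k))

  infixl 7 _⋆_

  _⋆_ : (ℕ → Carrier) → (ℕ → Carrier) → ℕ → Carrier
  (f ⋆ g) n = Σ[0… n ] (λ j → fromℕ (n C j) * f (n ∸ j) * g j)

  δ : ℕ → Carrier
  δ zero    = 1#
  δ (suc _) = 0#

  ⋆-cong : ∀ {f f′ g g′ : ℕ → Carrier} → (∀ i → f i ≈ f′ i) → (∀ i → g i ≈ g′ i) →
           ∀ n → (f ⋆ g) n ≈ (f′ ⋆ g′) n
  ⋆-cong f≈f′ g≈g′ n = Σ-cong n (λ j → *-cong (*-congˡ (f≈f′ (n ∸ j))) (g≈g′ j))

  ⋆-zero : ∀ f g → (f ⋆ g) 0 ≈ f 0 * g 0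
  ⋆-zero f g = *-congʳ (trans (*-congʳ (+-identityʳ 1#)) (*-identityˡ (f 0)))

  ⋆-distribʳ-+ : ∀ f f′ g n → ((λ i → f i + f′ i) ⋆ g) n ≈ (f ⋆ g) n + (f′ ⋆ g) n
  ⋆-distribʳ-+ f f′ g n = trans (Σ-cong n (λ j → trans (*-congʳ (distribˡ _ _ _)) (distribʳ _ _ _))) (Σ-distrib-+ n _ _)

  ⋆-distribˡ-+ : ∀ f g g′ n → (f ⋆ (λ i → g i + g′ i)) n ≈ (f ⋆ g) n + (f ⋆ g′) n
  ⋆-distribˡ-+ f g g′ n = trans (Σ-cong n (λ j → distribˡ _ _ _)) (Σ-distrib-+ n _ _)

  ⋆-scaleˡ : ∀ x f g n → ((λ i → x * f i) ⋆ g) n ≈ x * (f ⋆ g) n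
  ⋆-scaleˡ x f g n = sym (trans (*-distribˡ-Σ x n _) (Σ-cong n (λ j →
    solve 4 (λ x k a b → x :* (k :* a :* b) := k :* (x :* a) :* b) refl x _ _ _)))

  ⋆-scaleʳ : ∀ x f g n → (f ⋆ (λ i → x * g i)) n ≈ x * (f ⋆ g) n
  ⋆-scaleʳ x f g n = sym (trans (*-distribˡ-Σ x n _) (Σ-cong n (λ j →
    solve 4 (λ x k a b → x :* (k :* a :* b) := k :* a :* (x :* b)) refl x _ _ _)))

  ⋆-leibniz : ∀ f g n → (f ⋆ g) (suc n) ≈ ((f ∘ suc) ⋆ g) n + (f ⋆ (g ∘ suc)) n
  ⋆-leibniz f g n = begin
    (f ⋆ g) (suc n)                                    ≈⟨ Σ-head n h ⟩
    h 0 + Σ[0… n ] (h ∘ suc)                           ≈⟨ +-congˡ (Σ-cong n pascal) ⟩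
    h 0 + Σ[0… n ] (λ j → l j + k (suc j))             ≈⟨ +-congˡ (Σ-distrib-+ n l (k ∘ suc)) ⟩
    h 0 + ((f ⋆ (g ∘ suc)) n + Σ[0… n ] (k ∘ suc))     ≈⟨ x+[y+z]≈y+[x+z] _ _ _ ⟩
    (f ⋆ (g ∘ suc)) n + (k 0 + Σ[0… n ] (k ∘ suc))     ≈⟨ +-congˡ (Σ-head n k) ⟨
    (f ⋆ (g ∘ suc)) n + (Σ[0… n ] k + k (suc n))       ≈⟨ +-congˡ (+-cong (Σ-cong-≤ n k≈) k-top) ⟩
    (f ⋆ (g ∘ suc)) n + (((f ∘ suc) ⋆ g) n + 0#)       ≈⟨ trans (+-congˡ (+-identityʳ _)) (+-comm _ _) ⟩
    ((f ∘ suc) ⋆ g) n + (f ⋆ (g ∘ suc)) n              ∎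
    where
    h k l : ℕ → Carrier
    h j = fromℕ (suc n C j) * f (suc n ∸ j) * g j
    k j = fromℕ (n C j) * f (suc n ∸ j) * g j
    l j = fromℕ (n C j) * f (n ∸ j) * g (suc j)

    pascal : ∀ j → h (suc j) ≈ l j + k (suc j)
    pascal j = begin
      fromℕ (suc n C suc j) * f (n ∸ j) * g (suc j)
        ≡⟨ ≡.cong (λ m → fromℕ m * f (n ∸ j) * g (suc j)) (nCk+nC[k+1]≡[n+1]C[k+1] n j) ⟨
      fromℕ (n C j ℕ.+ n C suc j) * f (n ∸ j) * g (suc j)
        ≈⟨ *-congʳ (*-congʳ (fromℕ-+ (n C j) (n C suc j))) ⟩
      (fromℕ (n C j) + fromℕ (n C suc j)) * f (n ∸ j) * g (suc j)
        ≈⟨ trans (*-congʳ (distribʳ _ _ _)) (distribʳ _ _ _) ⟩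
      l j + k (suc j) ∎

    k≈ : ∀ j → j ≤ n → k j ≈ fromℕ (n C j) * f (suc (n ∸ j)) * g j
    k≈ j j≤n = reflexive (≡.cong (λ m → fromℕ (n C j) * f m * g j) (ℕ.+-∸-assoc 1 j≤n))

    k-top : k (suc n) ≈ 0#
    k-top = begin
      fromℕ (n C suc n) * f (n ∸ n) * g (suc n)  ≡⟨ ≡.cong (λ m → fromℕ m * f (n ∸ n) * g (suc n)) (k>n⇒nCk≡0 (ℕ.n<1+n n)) ⟩
      0# * f (n ∸ n) * g (suc n)                 ≈⟨ trans (*-congʳ (zeroˡ _)) (zeroˡ _) ⟩
      0#                                         ∎

  ⋆-assoc : ∀ f g h n → ((f ⋆ g) ⋆ h) n ≈ (f ⋆ (g ⋆ h)) n
  ⋆-assoc f g h zero = begin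
    ((f ⋆ g) ⋆ h) 0      ≈⟨ ⋆-zero (f ⋆ g) h ⟩
    (f ⋆ g) 0 * h 0      ≈⟨ *-congʳ (⋆-zero f g) ⟩
    f 0 * g 0 * h 0      ≈⟨ *-assoc _ _ _ ⟩
    f 0 * (g 0 * h 0)    ≈⟨ *-congˡ (⋆-zero g h) ⟨
    f 0 * (g ⋆ h) 0      ≈⟨ ⋆-zero f (g ⋆ h) ⟨
    (f ⋆ (g ⋆ h)) 0      ∎
  ⋆-assoc f g h (suc n) = begin
    ((f ⋆ g) ⋆ h) (suc n)
      ≈⟨ ⋆-leibniz (f ⋆ g) h n ⟩
    (((f ⋆ g) ∘ suc) ⋆ h) n + ((f ⋆ g) ⋆ (h ∘ suc)) n
      ≈⟨ +-congʳ (⋆-cong {g = h} {g′ = h} (⋆-leibniz f g) (λ _ → refl) n) ⟩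
    ((λ i → ((f ∘ suc) ⋆ g) i + (f ⋆ (g ∘ suc)) i) ⋆ h) n + ((f ⋆ g) ⋆ (h ∘ suc)) n
      ≈⟨ +-congʳ (⋆-distribʳ-+ ((f ∘ suc) ⋆ g) (f ⋆ (g ∘ suc)) h n) ⟩
    ((((f ∘ suc) ⋆ g) ⋆ h) n + ((f ⋆ (g ∘ suc)) ⋆ h) n) + ((f ⋆ g) ⋆ (h ∘ suc)) n
      ≈⟨ +-cong (+-cong (⋆-assoc (f ∘ suc) g h n) (⋆-assoc f (g ∘ suc) h n)) (⋆-assoc f g (h ∘ suc) n) ⟩
    (((f ∘ suc) ⋆ (g ⋆ h)) n + (f ⋆ ((g ∘ suc) ⋆ h)) n) + (f ⋆ (g ⋆ (h ∘ suc))) n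
      ≈⟨ +-assoc _ _ _ ⟩
    ((f ∘ suc) ⋆ (g ⋆ h)) n + ((f ⋆ ((g ∘ suc) ⋆ h)) n + (f ⋆ (g ⋆ (h ∘ suc))) n)
      ≈⟨ +-congˡ (⋆-distribˡ-+ f _ _ n) ⟨
    ((f ∘ suc) ⋆ (g ⋆ h)) n + (f ⋆ (λ i → ((g ∘ suc) ⋆ h) i + (g ⋆ (h ∘ suc)) i)) n
      ≈⟨ +-congˡ (⋆-cong {f = f} {f′ = f} (λ _ → refl) (λ i → sym (⋆-leibniz g h i)) n) ⟩
    ((f ∘ suc) ⋆ (g ⋆ h)) n + (f ⋆ ((g ⋆ h) ∘ suc)) n
      ≈⟨ ⋆-leibniz f (g ⋆ h) n ⟨
    (f ⋆ (g ⋆ h)) (suc n) ∎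

  ⋆-identityʳ : ∀ f n → (f ⋆ δ) n ≈ f n
  ⋆-identityʳ f zero    = trans (⋆-zero f δ) (*-identityʳ (f 0))
  ⋆-identityʳ f (suc n) = begin
    (f ⋆ δ) (suc n)                                ≈⟨ ⋆-leibniz f δ n ⟩
    ((f ∘ suc) ⋆ δ) n + (f ⋆ (λ _ → 0#)) n         ≈⟨ +-congˡ (⋆-cong {f = f} {f′ = f} (λ _ → refl) (λ _ → sym (zeroˡ 0#)) n) ⟩
    ((f ∘ suc) ⋆ δ) n + (f ⋆ (λ _ → 0# * 0#)) n    ≈⟨ +-cong (⋆-identityʳ (f ∘ suc) n) (⋆-scaleʳ 0# f _ n) ⟩
    f (suc n) + 0# * (f ⋆ (λ _ → 0#)) n            ≈⟨ +-congˡ (zeroˡ _) ⟩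
    f (suc n) + 0#                                 ≈⟨ +-identityʳ _ ⟩
    f (suc n)                                      ∎

  pow⋆-suc : ∀ a f n → ((a ^_) ⋆ f) (suc n) ≈ a * ((a ^_) ⋆ f) n + ((a ^_) ⋆ (f ∘ suc)) n
  pow⋆-suc a f n = trans (⋆-leibniz (a ^_) f n) (+-congʳ (⋆-scaleˡ a (a ^_) f n))

  pow⋆pow : ∀ {a b e} → a + b ≈ e → ∀ n → ((a ^_) ⋆ (b ^_)) n ≈ e ^ n
  pow⋆pow {a} {b} a+b≈e zero = trans (⋆-zero (a ^_) (b ^_)) (*-identityˡ 1#)
  pow⋆pow {a} {b} {e} a+b≈e (suc n) = begin
    ((a ^_) ⋆ (b ^_)) (suc n)                           ≈⟨ pow⋆-suc a (b ^_) n ⟩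
    a * ((a ^_) ⋆ (b ^_)) n + ((a ^_) ⋆ (λ i → b * b ^ i)) n ≈⟨ +-congˡ (⋆-scaleʳ b (a ^_) (b ^_) n) ⟩
    a * ((a ^_) ⋆ (b ^_)) n + b * ((a ^_) ⋆ (b ^_)) n   ≈⟨ distribʳ _ a b ⟨
    (a + b) * ((a ^_) ⋆ (b ^_)) n                       ≈⟨ *-cong a+b≈e (pow⋆pow a+b≈e n) ⟩
    e ^ suc n                                           ∎

  binomial-expansion : ∀ {a u} {Z : ℕ → Carrier} → (∀ k → Z k ≈ (a - u) ^ k) →
                       ∀ n → Σ[0… n ] (λ k → fromℕ (n C k) * Z k * u ^ (n ∸ k)) ≈ a ^ n
  binomial-expansion {a} {u} Z≈ n = begin
    Σ[0… n ] (λ k → fromℕ (n C k) * _ * u ^ (n ∸ k))  ≈⟨ Σ-cong n (λ k → trans ([x*y]*z≈[x*z]*y _ _ _) (*-congˡ (Z≈ k))) ⟩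
    ((u ^_) ⋆ ((a - u) ^_)) n                         ≈⟨ pow⋆pow (solve 2 (λ a u → u :+ (a :- u) := a) refl a u) n ⟩
    a ^ n                                             ∎

  -- Euler inversion

  evenPowers : Carrier → ℕ → Carrier
  evenPowers d zero          = 1#
  evenPowers d (suc zero)    = 0#
  evenPowers d (suc (suc j)) = d * evenPowers d j

  oddPowers : Carrier → ℕ → Carrier
  oddPowers d zero    = 0#
  oddPowers d (suc j) = evenPowers d j

  evenPowers-suc : ∀ d j → evenPowers d (suc j) ≈ d * oddPowers d j
  evenPowers-suc d zero    = sym (zeroʳ d)
  evenPowers-suc d (suc j) = refl

  evenPowers-+ : ∀ d k j → evenPowers d (2 *ℕ k ℕ.+ j) ≈ d ^ k * evenPowers d j
  evenPowers-+ d zero    j = sym (*-identityˡ _)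
  evenPowers-+ d (suc k) j = begin
    evenPowers d (2 *ℕ suc k ℕ.+ j)   ≡⟨ ≡.cong (λ m → evenPowers d (m ℕ.+ j)) (ℕ.*-suc 2 k) ⟩
    d * evenPowers d (2 *ℕ k ℕ.+ j)   ≈⟨ *-congˡ (evenPowers-+ d k j) ⟩
    d * (d ^ k * evenPowers d j)      ≈⟨ *-assoc _ _ _ ⟨
    d ^ suc k * evenPowers d j        ∎

  evenPowers-double : ∀ d k → evenPowers d (2 *ℕ k) ≈ d ^ k
  evenPowers-double d k = begin
    evenPowers d (2 *ℕ k)         ≡⟨ ≡.cong (evenPowers d) (ℕ.+-identityʳ (2 *ℕ k)) ⟨
    evenPowers d (2 *ℕ k ℕ.+ 0)   ≈⟨ evenPowers-+ d k 0 ⟩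
    d ^ k * 1#                    ≈⟨ *-identityʳ _ ⟩
    d ^ k                         ∎

  evenPowers-odd : ∀ d k → evenPowers d (suc (2 *ℕ k)) ≈ 0#
  evenPowers-odd d k = begin
    evenPowers d (suc (2 *ℕ k))   ≡⟨ ≡.cong (evenPowers d) (ℕ.+-comm 1 (2 *ℕ k)) ⟩
    evenPowers d (2 *ℕ k ℕ.+ 1)   ≈⟨ evenPowers-+ d k 1 ⟩
    d ^ k * 0#                    ≈⟨ zeroʳ _ ⟩
    0#                            ∎

  E : ℕ → Carrier
  E j = fromℤ (euler j)

  E-odd : ∀ k → E (suc (2 *ℕ k)) ≈ 0#
  E-odd k = reflexive (≡.cong fromℤ (euler-odd k))

  fromℤ-sum-tabulate : ∀ m (f : Fin (suc m) → ℤ) (F : ℕ → Carrier) → (∀ i → F (toℕ i) ≈ fromℤ (f i)) →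
                       fromℤ (Vec.foldr (λ _ → ℤ) ℤ._+_ (+ 0) (tabulate f)) ≈ Σ[0… m ] F
  fromℤ-sum-tabulate zero f F F≈ = trans (fromℤ-+ (f Fin.zero) (+ 0)) (trans (+-identityʳ _) (sym (F≈ Fin.zero)))
  fromℤ-sum-tabulate (suc m) f F F≈ = begin
    fromℤ (f Fin.zero ℤ.+ rest)   ≈⟨ fromℤ-+ (f Fin.zero) rest ⟩
    fromℤ (f Fin.zero) + fromℤ rest
      ≈⟨ +-cong (sym (F≈ Fin.zero)) (fromℤ-sum-tabulate m (f ∘ Fin.suc) (F ∘ suc) (F≈ ∘ Fin.suc)) ⟩
    F 0 + Σ[0… m ] (F ∘ suc)      ≈⟨ Σ-head m F ⟨
    Σ[0… suc m ] F                ∎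
    where
    rest : ℤ
    rest = Vec.foldr (λ _ → ℤ) ℤ._+_ (+ 0) (tabulate (f ∘ Fin.suc))

  eulerEven-recurrence : ∀ m → Σ[0… suc m ] (λ k → fromℕ ((2 *ℕ suc m) C (2 *ℕ k)) * fromℤ (eulerEven k)) ≈ 0#
  eulerEven-recurrence m = begin
    Σ[0… m ] F + F (suc m)                  ≡⟨ ≡.cong (λ z → Σ[0… m ] F + z) F-last ⟩
    Σ[0… m ] F + fromℕ 1 * fromℤ (ℤ.- sum)  ≈⟨ +-congˡ (*-cong (+-identityʳ 1#) (fromℤ-neg sum)) ⟩
    Σ[0… m ] F + 1# * - fromℤ sum           ≈⟨ +-congˡ (trans (*-identityˡ _) (-‿cong (fromℤ-sum-tabulate m term F F≈))) ⟩
    Σ[0… m ] F - Σ[0… m ] F                 ≈⟨ -‿inverseʳ _ ⟩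
    0#                                      ∎
    where
    F : ℕ → Carrier
    F k = fromℕ ((2 *ℕ suc m) C (2 *ℕ k)) * fromℤ (eulerEven k)
    term : Fin (suc m) → ℤ
    term i = + ((2 *ℕ suc m) C (2 *ℕ toℕ i)) ℤ.* lookup (eulerEvens m) i
    sum : ℤ
    sum = Vec.foldr (λ _ → ℤ) ℤ._+_ (+ 0) (tabulate term)
    F-last : F (suc m) ≡ fromℕ 1 * fromℤ (ℤ.- sum)
    F-last = ≡.cong₂ (λ a b → fromℕ a * fromℤ b) (nCn≡1 (2 *ℕ suc m)) (Vec.last-∷ʳ _ (eulerEvens m))
    F≈ : ∀ i → F (toℕ i) ≈ fromℤ (term i)
    F≈ i = sym (trans (fromℤ-pos-*ˡ ((2 *ℕ suc m) C (2 *ℕ toℕ i)) (lookup (eulerEvens m) i))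
                      (*-congˡ (reflexive (≡.cong fromℤ (lookup-eulerEvens m i)))))

  euler-recurrence : ∀ m → Σ[0… 2 *ℕ suc m ] (λ j → fromℕ ((2 *ℕ suc m) C j) * E j) ≈ 0#
  euler-recurrence m = begin
    Σ[0… 2 *ℕ suc m ] g                                        ≈⟨ Σ-even (2 *ℕ suc m) g g-odd ⟩
    Σ[0… ⌊ 2 *ℕ suc m /2⌋ ] (λ k → g (2 *ℕ k))                 ≡⟨ ≡.cong (λ b → Σ[0… b ] (λ k → g (2 *ℕ k))) (⌊2*n/2⌋≡n (suc m)) ⟩
    Σ[0… suc m ] (λ k → g (2 *ℕ k))                            ≈⟨ Σ-cong (suc m) (λ k → *-congˡ (reflexive (≡.cong fromℤ (euler-double k)))) ⟩
    Σ[0… suc m ] (λ k → fromℕ ((2 *ℕ suc m) C (2 *ℕ k)) * fromℤ (eulerEven k)) ≈⟨ eulerEven-recurrence m ⟩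
    0#                                                         ∎
    where
    g : ℕ → Carrier
    g j = fromℕ ((2 *ℕ suc m) C j) * E j
    g-odd : ∀ k → g (suc (2 *ℕ k)) ≈ 0#
    g-odd k = trans (*-congˡ (E-odd k)) (zeroʳ _)

  -- cosh(√d z) · sech(√d z) = 1, coefficientwise
  evenPowers⋆euler : ∀ d m → (evenPowers d ⋆ (λ j → evenPowers d j * E j)) m ≈ δ m
  evenPowers⋆euler d m = trans (Σ-cong-≤ m factor) (trans (sym (*-distribˡ-Σ _ m _)) (collapse m (evenOdd m)))
    where
    S : ℕ → Carrier
    S n = Σ[0… n ] (λ j → fromℕ (n C j) * E j)

    evenPowers-split : ∀ j → j ≤ m → evenPowers d (m ∸ j) * (evenPowers d j * E j) ≈ evenPowers d m * E j
    evenPowers-split j j≤m with evenOdd j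
    ... | even k = begin
      evenPowers d (m ∸ 2 *ℕ k) * (evenPowers d (2 *ℕ k) * E (2 *ℕ k))
        ≈⟨ *-congˡ (*-congʳ (evenPowers-double d k)) ⟩
      evenPowers d (m ∸ 2 *ℕ k) * (d ^ k * E (2 *ℕ k))
        ≈⟨ trans (x*[y*z]≈y*[x*z] _ _ _) (sym (*-assoc _ _ _)) ⟩
      d ^ k * evenPowers d (m ∸ 2 *ℕ k) * E (2 *ℕ k)
        ≈⟨ *-congʳ (evenPowers-+ d k (m ∸ 2 *ℕ k)) ⟨
      evenPowers d (2 *ℕ k ℕ.+ (m ∸ 2 *ℕ k)) * E (2 *ℕ k)
        ≡⟨ ≡.cong (λ i → evenPowers d i * E (2 *ℕ k)) (ℕ.m+[n∸m]≡n j≤m) ⟩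
      evenPowers d m * E (2 *ℕ k) ∎
    ... | odd k = begin
      evenPowers d (m ∸ suc (2 *ℕ k)) * (evenPowers d (suc (2 *ℕ k)) * E (suc (2 *ℕ k)))
        ≈⟨ *-congˡ (*-congˡ (E-odd k)) ⟩
      evenPowers d (m ∸ suc (2 *ℕ k)) * (evenPowers d (suc (2 *ℕ k)) * 0#)
        ≈⟨ trans (*-congˡ (zeroʳ _)) (zeroʳ _) ⟩
      0#
        ≈⟨ trans (*-congˡ (E-odd k)) (zeroʳ _) ⟨
      evenPowers d m * E (suc (2 *ℕ k)) ∎

    factor : ∀ j → j ≤ m → fromℕ (m C j) * evenPowers d (m ∸ j) * (evenPowers d j * E j)
                           ≈ evenPowers d m * (fromℕ (m C j) * E j)
    factor j j≤m = trans (*-assoc _ _ _) (trans (*-congˡ (evenPowers-split j j≤m)) (x*[y*z]≈y*[x*z] _ _ _))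

    collapse : ∀ m → EvenOdd m → evenPowers d m * S m ≈ δ m
    collapse _ (even zero)    = trans (*-identityˡ _) (trans (*-cong (+-identityʳ 1#) (+-identityʳ 1#)) (*-identityˡ 1#))
    collapse _ (even (suc k)) = trans (*-congˡ (euler-recurrence k)) (zeroʳ _)
    collapse _ (odd k)        = trans (*-congʳ (evenPowers-odd d k)) (zeroˡ _)

  euler-inversion : ∀ {a d} {X : ℕ → Carrier} → (∀ m → X m ≈ ((a ^_) ⋆ evenPowers d) m) → ∀ n →
                    Σ[0… ⌊ n /2⌋ ] (λ k → fromℕ (n C (2 *ℕ k)) * X (n ∸ 2 *ℕ k) * d ^ k * E (2 *ℕ k)) ≈ a ^ n
  euler-inversion {a} {d} {X} X≈ n = begin
    Σ[0… ⌊ n /2⌋ ] (λ k → fromℕ (n C (2 *ℕ k)) * X (n ∸ 2 *ℕ k) * d ^ k * E (2 *ℕ k))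
      ≈⟨ Σ-cong ⌊ n /2⌋ (λ k → trans (*-assoc _ _ _) (*-congˡ (*-congʳ (sym (evenPowers-double d k))))) ⟩
    Σ[0… ⌊ n /2⌋ ] (λ k → g (2 *ℕ k))  ≈⟨ Σ-even n g g-odd ⟨
    (X ⋆ e) n                          ≈⟨ ⋆-cong X≈ (λ _ → refl) n ⟩
    (((a ^_) ⋆ evenPowers d) ⋆ e) n    ≈⟨ ⋆-assoc (a ^_) (evenPowers d) e n ⟩
    ((a ^_) ⋆ (evenPowers d ⋆ e)) n    ≈⟨ ⋆-cong {f = a ^_} {f′ = a ^_} (λ _ → refl) (evenPowers⋆euler d) n ⟩
    ((a ^_) ⋆ δ) n                     ≈⟨ ⋆-identityʳ (a ^_) n ⟩
    a ^ n                              ∎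
    where
    e g : ℕ → Carrier
    e j = evenPowers d j * E j
    g j = fromℕ (n C j) * X (n ∸ j) * e j
    g-odd : ∀ k → g (suc (2 *ℕ k)) ≈ 0#
    g-odd k = trans (*-congˡ (trans (*-congˡ (E-odd k)) (zeroʳ _))) (zeroʳ _)

  -- Balancing polynomials of even index

  module PowersOfMatrix (a b c d : Carrier) (bc≈d : b * c ≈ d) (X Y : ℕ → Carrier)
    (X-zero : X 0 ≈ 1#) (Y-zero : Y 0 ≈ 0#)
    (X-suc : ∀ m → X (suc m) ≈ a * X m + b * Y m)
    (Y-suc : ∀ m → Y (suc m) ≈ c * X m + a * Y m) where

    X,Y≈pow⋆ : ∀ m → X m ≈ ((a ^_) ⋆ evenPowers d) m × Y m ≈ c * ((a ^_) ⋆ oddPowers d) m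
    X,Y≈pow⋆ zero =
      trans X-zero (sym (trans (⋆-zero (a ^_) (evenPowers d)) (*-identityʳ 1#))) ,
      trans Y-zero (sym (trans (*-congˡ (trans (⋆-zero (a ^_) (oddPowers d)) (zeroʳ 1#))) (zeroʳ c)))
    X,Y≈pow⋆ (suc m) = X-step , Y-step
      where
      P Q : Carrier
      P = ((a ^_) ⋆ evenPowers d) m
      Q = ((a ^_) ⋆ oddPowers d) m

      X-step : X (suc m) ≈ ((a ^_) ⋆ evenPowers d) (suc m)
      X-step = begin
        X (suc m)                                        ≈⟨ X-suc m ⟩
        a * X m + b * Y m                                ≈⟨ +-cong (*-congˡ (proj₁ (X,Y≈pow⋆ m))) (*-congˡ (proj₂ (X,Y≈pow⋆ m))) ⟩
        a * P + b * (c * Q)                              ≈⟨ +-congˡ (trans (sym (*-assoc b c Q)) (*-congʳ bc≈d)) ⟩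
        a * P + d * Q                                    ≈⟨ +-congˡ (⋆-scaleʳ d (a ^_) (oddPowers d) m) ⟨
        a * P + ((a ^_) ⋆ (λ j → d * oddPowers d j)) m   ≈⟨ +-congˡ (⋆-cong {f = a ^_} {f′ = a ^_} (λ _ → refl) (λ j → sym (evenPowers-suc d j)) m) ⟩
        a * P + ((a ^_) ⋆ (evenPowers d ∘ suc)) m        ≈⟨ pow⋆-suc a (evenPowers d) m ⟨
        ((a ^_) ⋆ evenPowers d) (suc m)                  ∎

      Y-step : Y (suc m) ≈ c * ((a ^_) ⋆ oddPowers d) (suc m)
      Y-step = begin
        Y (suc m)                                        ≈⟨ Y-suc m ⟩
        c * X m + a * Y m                                ≈⟨ +-cong (*-congˡ (proj₁ (X,Y≈pow⋆ m))) (*-congˡ (proj₂ (X,Y≈pow⋆ m))) ⟩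
        c * P + a * (c * Q)                              ≈⟨ +-comm _ _ ⟩
        a * (c * Q) + c * P                              ≈⟨ +-congʳ (x*[y*z]≈y*[x*z] a c Q) ⟩
        c * (a * Q) + c * P                              ≈⟨ distribˡ c _ _ ⟨
        c * (a * Q + P)                                  ≈⟨ *-congˡ (pow⋆-suc a (oddPowers d) m) ⟨
        c * ((a ^_) ⋆ oddPowers d) (suc m)               ∎

    X≈pow⋆evenPowers : ∀ m → X m ≈ ((a ^_) ⋆ evenPowers d) m
    X≈pow⋆evenPowers m = proj₁ (X,Y≈pow⋆ m)

    X-sY≈pow : ∀ s → b ≈ c * (s * s) → ∀ m → X m - s * Y m ≈ (a - c * s) ^ m
    X-sY≈pow s b≈css zero = begin
      X 0 - s * Y 0   ≈⟨ +-cong X-zero (-‿cong (trans (*-congˡ Y-zero) (zeroʳ s))) ⟩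
      1# - 0#         ≈⟨ +-congˡ -0#≈0# ⟩
      1# + 0#         ≈⟨ +-identityʳ 1# ⟩
      1#              ∎
    X-sY≈pow s b≈css (suc m) = begin
      X (suc m) - s * Y (suc m)
        ≈⟨ +-cong (X-suc m) (-‿cong (*-congˡ (Y-suc m))) ⟩
      (a * X m + b * Y m) - s * (c * X m + a * Y m)
        ≈⟨ +-congʳ (+-congˡ (*-congʳ b≈css)) ⟩
      (a * X m + c * (s * s) * Y m) - s * (c * X m + a * Y m)
        ≈⟨ solve 5 (λ a c s x y → (a :* x :+ c :* (s :* s) :* y) :- s :* (c :* x :+ a :* y)
                                  := (a :- c :* s) :* (x :- s :* y)) refl a c s (X m) (Y m) ⟩
      (a - c * s) * (X m - s * Y m)
        ≈⟨ *-congˡ (X-sY≈pow s b≈css m) ⟩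
      (a - c * s) ^ suc m
        ∎

  Recurrent : Carrier → (ℕ → Carrier) → Set ℓ
  Recurrent T u = ∀ n → u (suc (suc n)) ≈ T * u (suc n) - u n

  recurrent-lincomb : ∀ {T u v} α β → Recurrent T u → Recurrent T v → Recurrent T (λ n → α * u n + β * v n)
  recurrent-lincomb {T} {u} {v} α β u-rec v-rec n = begin
    α * u (suc (suc n)) + β * v (suc (suc n))
      ≈⟨ +-cong (*-congˡ (u-rec n)) (*-congˡ (v-rec n)) ⟩
    α * (T * u (suc n) - u n) + β * (T * v (suc n) - v n)
      ≈⟨ solve 7 (λ T α β u₁ u₀ v₁ v₀ → α :* (T :* u₁ :- u₀) :+ β :* (T :* v₁ :- v₀)
                                      := T :* (α :* u₁ :+ β :* v₁) :- (α :* u₀ :+ β :* v₀))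
                 refl T α β (u (suc n)) (u n) (v (suc n)) (v n) ⟩
    T * (α * u (suc n) + β * v (suc n)) - (α * u n + β * v n)
      ∎

  recurrent-unique : ∀ {T u v} → Recurrent T u → Recurrent T v → u 0 ≈ v 0 → u 1 ≈ v 1 → ∀ n → u n ≈ v n
  recurrent-unique {u = u} {v} u-rec v-rec u₀≈v₀ u₁≈v₁ n = proj₁ (agree n)
    where
    agree : ∀ n → u n ≈ v n × u (suc n) ≈ v (suc n)
    agree zero    = u₀≈v₀ , u₁≈v₁
    agree (suc n) = proj₂ (agree n) ,
      trans (u-rec n) (trans (+-cong (*-congˡ (proj₂ (agree n))) (-‿cong (proj₁ (agree n)))) (sym (v-rec n)))

  module Doubling (x : Carrier) where
    t w a D : Carrier
    t = fromℕ 6 * x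
    w = fromℕ 9 * (x * x) - 1#
    a = Cpoly 2 x
    D = fromℕ 36 * (x * x) * w

    Cpoly-2+ : ∀ n → Cpoly (2 ℕ.+ n) x ≈ a * Cpoly n x + t * w * Bstar n x
    Cpoly-2+ = recurrent-unique {u = λ n → Cpoly (2 ℕ.+ n) x} (λ _ → refl)
      (recurrent-lincomb a (t * w) (λ _ → refl) (λ _ → refl))
      (solve 2 (λ a b → a := a :* con (+ 1) :+ b :* con (+ 0)) refl a (t * w))
      (solve 1 (λ x → con (+ 6) :* x :* (con (+ 6) :* x :* (con (+ 3) :* x) :- con (+ 1)) :- con (+ 3) :* x
                   := (con (+ 6) :* x :* (con (+ 3) :* x) :- con (+ 1)) :* (con (+ 3) :* x)
                      :+ con (+ 6) :* x :* (con (+ 9) :* (x :* x) :- con (+ 1)) :* con (+ 1)) refl x)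

    Bstar-2+ : ∀ n → Bstar (2 ℕ.+ n) x ≈ t * Cpoly n x + a * Bstar n x
    Bstar-2+ = recurrent-unique {u = λ n → Bstar (2 ℕ.+ n) x} (λ _ → refl)
      (recurrent-lincomb t a (λ _ → refl) (λ _ → refl))
      (solve 2 (λ t a → t :* con (+ 1) :- con (+ 0) := t :* con (+ 1) :+ a :* con (+ 0)) refl t a)
      (solve 1 (λ x → con (+ 6) :* x :* (con (+ 6) :* x :* con (+ 1) :- con (+ 0)) :- con (+ 1)
                   := con (+ 6) :* x :* (con (+ 3) :* x)
                      :+ (con (+ 6) :* x :* (con (+ 3) :* x) :- con (+ 1)) :* con (+ 1)) refl x)

    open PowersOfMatrix a (t * w) t D
      (solve 1 (λ x → con (+ 6) :* x :* (con (+ 9) :* (x :* x) :- con (+ 1)) :* (con (+ 6) :* x)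
                   := con (+ 36) :* (x :* x) :* (con (+ 9) :* (x :* x) :- con (+ 1))) refl x)
      (λ m → Cpoly (2 *ℕ m) x) (λ m → Bstar (2 *ℕ m) x) refl refl
      (λ m → trans (reflexive (≡.cong (λ k → Cpoly k x) (ℕ.*-suc 2 m))) (Cpoly-2+ (2 *ℕ m)))
      (λ m → trans (reflexive (≡.cong (λ k → Bstar k x) (ℕ.*-suc 2 m))) (Bstar-2+ (2 *ℕ m)))
      public

theorem5 : ∀ {c ℓ} (R : CommutativeRing c ℓ) →
    let open CommutativeRing R
        open InRing R
    in (n : ℕ) (x s : Carrier) →
       s * s ≈ fromℕ 9 * (x * x) - 1# →
       Σ[0… ⌊ n /2⌋ ] (λ k → fromℕ (n C (2 *ℕ k)) * Cpoly (2 *ℕ (n ∸ 2 *ℕ k)) x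
                              * (fromℕ 36 * (x * x) * (fromℕ 9 * (x * x) - 1#)) ^ k
                              * fromℤ (euler (2 *ℕ k)))
       ≈ Σ[0… n ] (λ k → fromℕ (n C k) * (Cpoly (2 *ℕ k) x - s * Bstar (2 *ℕ k) x)
                          * (fromℕ 6 * x * s) ^ (n ∸ k))
theorem5 R n x s s*s≈w =
  trans (euler-inversion R X≈pow⋆evenPowers n)
        (sym (binomial-expansion R (X-sY≈pow s (*-congˡ (sym s*s≈w))) n))
  where
  open CommutativeRing R using (trans; sym; *-congˡ)
  open Doubling R x
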